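{- For all sentences $A,B\in\mathsf{Sent}_Q$: (i) if $\vdash_{i3}A\lor B$ then $\vdash_{i3}A$ or $\vdash_{i3}B$; (ii) if $\vdash_{i3}\exists xA$ then $\vdash_{i3}A(c)$ for some constant $c\in\mathsf{Con}$; (iii) if $\vdash_{i3}{\sim}(A\land B)$ then $\vdash_{i3}{\sim}A$ or $\vdash_{i3}{\sim}B$; (iv) if $\vdash_{i3}{\sim}\forall xA$ then $\vdash_{i3}{\sim}A(c)$ for some $c\in\mathsf{Con}$.
   Context: $\mathcal{L}_Q$: first-order language with $\bot,{\sim},\land,\lor,\to,\forall,\exists$, a countable set $\mathsf{Con}$ of constants, variables, predicate symbols; $\mathsf{Sent}_Q$ its sentences; $\neg A:=A\to\bot$, $A\leftrightarrow B:=(A\to B)\land(B\to A)$. $\vdash_{i3}$ is derivability (from no premises) in the Hilbert system $\mathbf{QBDi3}$ with axioms (Ax1) $A\to(B\to A)$; (Ax2) $(A\to(B\to C))\to((A\to B)\to(A\to C))$; (Ax4) $(A\land B)\to A$; (Ax5) $(A\land B)\to B$; (Ax6) $(C\to A)\to((C\to B)\to(C\to(A\land B)))$; (Ax7) $A\to(A\lor B)$; (Ax8) $B\to(A\lor B)$; (Ax9) $(A\to C)\to((B\to C)\to((A\lor B)\to C))$; (Ax10) $\bot\to A$; (Ax11) $A(t)\to\exists xA$; (Ax12) $\forall x(A(x)\to B)\to(\exists xA(x)\to B)$ ($x$ not free in $B$); (Ax13) $\forall x(B\to A)\to(B\to\forall xA)$ ($x$ not free in $B$); (Ax14) $\forall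 xA\to A(t)$; (Ax15) $A\to{\sim}\bot$; (Ax16) ${\sim}{\sim}A\leftrightarrow A$; (Ax17) ${\sim}(A\land B)\leftrightarrow({\sim}A\lor{\sim}B)$; (Ax18) ${\sim}(A\lor B)\leftrightarrow({\sim}A\land{\sim}B)$; (Ax19) ${\sim}(A\to B)\leftrightarrow(\neg{\sim}A\land{\sim}B)$; (Ax20) ${\sim}\forall xA\leftrightarrow\exists x{\sim}A$; (Ax21) ${\sim}\exists xA\leftrightarrow\forall x{\sim}A$; (i1) $\forall x\neg\neg A\to\neg\neg\forall xA$; (i2) ${\sim}A\to\neg A$; (i3) $\neg\neg(A\lor{\sim}A)$; rules MP (from $A$, $A\to B$ infer $B$) and Gen (from $A$ infer $\forall xA$). -}

module Defs where

open import Data.Nat using (ℕ; zero; suc; _<_)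
open import Data.List using (List; []; _∷_)
open import Data.List.Relation.Unary.All using (All)
open import Data.Unit using (⊤)
open import Data.Product using (_×_)

-- Terms: de Bruijn variables and constants (Con = ℕ, countable)
data Term : Set where
  var : ℕ → Term
  con : ℕ → Term

-- Formulas of L_Q; predicate symbols are named by ℕ and applied to a list
-- of argument terms (a symbol together with its arity).
infix 4 _⇔_
infixr 5 _⇒_
infix 9 ∼_
infixr 6 _∨'_
infixr 7 _∧'_
data Fm : Set where
  ⊥'   : Fm
  pred : ℕ → List Term → Fm
  ∼_   : Fm → Fm
  _∧'_ : Fm → Fm → Fm
  _∨'_ : Fm → Fm → Fm
  _⇒_  : Fm → Fm → Fm
  ∀'   : Fm → Fm      -- binds de Bruijn variable 0
  ∃'   : Fm → Fm

¬' : Fm → Fm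
¬' A = A ⇒ ⊥'

_⇔_ : Fm → Fm → Fm
A ⇔ B = (A ⇒ B) ∧' (B ⇒ A)

shiftVar : ℕ → ℕ → ℕ
shiftVar zero i = suc i
shiftVar (suc c) zero = zero
shiftVar (suc c) (suc i) = suc (shiftVar c i)

shiftT : ℕ → Term → Term
shiftT c (var i) = var (shiftVar c i)
shiftT c (con k) = con k

shiftTs : ℕ → List Term → List Term
shiftTs c [] = []
shiftTs c (t ∷ ts) = shiftT c t ∷ shiftTs c ts

shiftF : ℕ → Fm → Fm
shiftF c ⊥' = ⊥'
shiftF c (pred p ts) = pred p (shiftTs c ts)
shiftF c (∼ A) = ∼ shiftF c A
shiftF c (A ∧' B) = shiftF c A ∧' shiftF c B
shiftF c (A ∨' B) = shiftF c A ∨' shiftF c B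
shiftF c (A ⇒ B) = shiftF c A ⇒ shiftF c B
shiftF c (∀' A) = ∀' (shiftF (suc c) A)
shiftF c (∃' A) = ∃' (shiftF (suc c) A)

-- weakening: B seen under one more binder (so the bound variable is not free in it)
wk : Fm → Fm
wk = shiftF 0

substVar : ℕ → Term → ℕ → Term
substVar zero t zero = t
substVar zero t (suc i) = var i
substVar (suc k) t zero = var zero
substVar (suc k) t (suc i) = shiftT 0 (substVar k t i)

substT : ℕ → Term → Term → Term
substT k t (var i) = substVar k t i
substT k t (con c) = con c

substTs : ℕ → Term → List Term → List Term
substTs k t [] = []
substTs k t (s ∷ ss) = substT k t s ∷ substTs k t ss

substF : ℕ → Term → Fm → Fm
substF k t ⊥' = ⊥'
substF k t (pred p ts) = pred p (substTs k t ts)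
substF k t (∼ A) = ∼ substF k t A
substF k t (A ∧' B) = substF k t A ∧' substF k t B
substF k t (A ∨' B) = substF k t A ∨' substF k t B
substF k t (A ⇒ B) = substF k t A ⇒ substF k t B
substF k t (∀' A) = ∀' (substF (suc k) t A)
substF k t (∃' A) = ∃' (substF (suc k) t A)

_[_] : Fm → Term → Fm
A [ t ] = substF 0 t A

FreeBelowT : ℕ → Term → Set
FreeBelowT k (var i) = i < k
FreeBelowT k (con c) = ⊤

FreeBelow : ℕ → Fm → Set
FreeBelow k ⊥' = ⊤
FreeBelow k (pred p ts) = All (FreeBelowT k) ts
FreeBelow k (∼ A) = FreeBelow k A
FreeBelow k (A ∧' B) = FreeBelow k A × FreeBelow k B
FreeBelow k (A ∨' B) = FreeBelow k A × FreeBelow k B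
FreeBelow k (A ⇒ B) = FreeBelow k A × FreeBelow k B
FreeBelow k (∀' A) = FreeBelow (suc k) A
FreeBelow k (∃' A) = FreeBelow (suc k) A

Sentence : Fm → Set
Sentence = FreeBelow 0

-- Hilbert system QBDi3 (derivability from no premises, over all formulas)
infix 3 ⊢_
data ⊢_ : Fm → Set where
  ax1  : ∀ A B → ⊢ A ⇒ (B ⇒ A)
  ax2  : ∀ A B C → ⊢ (A ⇒ (B ⇒ C)) ⇒ ((A ⇒ B) ⇒ (A ⇒ C))
  ax4  : ∀ A B → ⊢ (A ∧' B) ⇒ A
  ax5  : ∀ A B → ⊢ (A ∧' B) ⇒ B
  ax6  : ∀ A B C → ⊢ (C ⇒ A) ⇒ ((C ⇒ B) ⇒ (C ⇒ (A ∧' B)))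
  ax7  : ∀ A B → ⊢ A ⇒ (A ∨' B)
  ax8  : ∀ A B → ⊢ B ⇒ (A ∨' B)
  ax9  : ∀ A B C → ⊢ (A ⇒ C) ⇒ ((B ⇒ C) ⇒ ((A ∨' B) ⇒ C))
  ax10 : ∀ A → ⊢ ⊥' ⇒ A
  ax11 : ∀ A t → ⊢ (A [ t ]) ⇒ ∃' A
  ax12 : ∀ A B → ⊢ ∀' (A ⇒ wk B) ⇒ (∃' A ⇒ B)
  ax13 : ∀ A B → ⊢ ∀' (wk B ⇒ A) ⇒ (B ⇒ ∀' A)
  ax14 : ∀ A t → ⊢ ∀' A ⇒ (A [ t ])
  ax15 : ∀ A → ⊢ A ⇒ ∼ ⊥'
  ax16 : ∀ A → ⊢ (∼ ∼ A) ⇔ A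
  ax17 : ∀ A B → ⊢ ∼ (A ∧' B) ⇔ (∼ A ∨' ∼ B)
  ax18 : ∀ A B → ⊢ ∼ (A ∨' B) ⇔ (∼ A ∧' ∼ B)
  ax19 : ∀ A B → ⊢ ∼ (A ⇒ B) ⇔ (¬' (∼ A) ∧' ∼ B)
  ax20 : ∀ A → ⊢ ∼ ∀' A ⇔ ∃' (∼ A)
  ax21 : ∀ A → ⊢ ∼ ∃' A ⇔ ∀' (∼ A)
  i1   : ∀ A → ⊢ ∀' (¬' (¬' A)) ⇒ ¬' (¬' (∀' A))
  i2   : ∀ A → ⊢ ∼ A ⇒ ¬' A
  i3   : ∀ A → ⊢ ¬' (¬' (A ∨' ∼ A))
  mp   : ∀ {A B} → ⊢ A → ⊢ A ⇒ B → ⊢ B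
  gen  : ∀ {A} → ⊢ A → ⊢ ∀' A

-- An Aczel slash.  For an assignment ρ of constants to the free variables,
-- ρ ⊩⁺ A is defined by recursion on A: a disjunction or existential is slashed
-- when one disjunct or one constant instance is, while an implication or a
-- universal formula must in addition be derivable once closed by ρ; ρ ⊩⁻ A
-- does the same for ∼ A.  Slashed formulas are derivable after closing, and by
-- induction on derivations every derivable formula is slashed; the negation
-- axioms i1–i3 are slashed only because QBDi3 is consistent, which a
-- two-valued model shows.  Slashing a derivable sentence A ∨ B, ∃x A,
-- ∼(A ∧ B) or ∼∀x A then exhibits the derivable disjunct or instance.

module Submission where

open import Defs
open import Data.Bool using (Bool; true; false; not; _∧_; _∨_; T)
open import Data.Bool.Properties using (T-∧)
open import Data.Empty using (⊥)
open import Data.List using ([]; _∷_; map)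
open import Data.List.Properties using (map-cong; map-∘; map-id-local)
import Data.List.Relation.Unary.All as All
open import Data.Nat using (ℕ; zero; suc; _<_; s≤s)
open import Data.Product using (_×_; _,_; proj₁; proj₂; ∃-syntax)
open import Data.Product.Function.NonDependent.Propositional using (_×-⇔_)
open import Data.Sum as Sum using (_⊎_; inj₁; inj₂)
open import Data.Sum.Function.Propositional using (_⊎-⇔_)
open import Data.Unit using (⊤; tt)
open import Function using (_∘_; id)
open import Function.Bundles using (module Equivalence; mk⇔) renaming (_⇔_ to _⟺_)
open import Function.Construct.Identity using (⇔-id)
open import Function.Related.TypeIsomorphisms using (→-cong-⇔)
open import Relation.Binary.PropositionalEquality
  using (_≡_; refl; sym; trans; cong; cong₂; subst; _≗_; module ≡-Reasoning)
open import Relation.Nullary using (¬_)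

open Equivalence using (to; from)

-- Parallel substitution

Sub : Set
Sub = ℕ → Term

infixr 5 _∷ₛ_
_∷ₛ_ : {X : Set} → X → (ℕ → X) → ℕ → X
(x ∷ₛ f) zero = x
(x ∷ₛ f) (suc i) = f i

subT : Sub → Term → Term
subT σ (var i) = σ i
subT σ (con c) = con c

⇑ : Sub → Sub
⇑ σ = var zero ∷ₛ shiftT 0 ∘ σ

⇑^ : ℕ → Sub → Sub
⇑^ zero σ = σ
⇑^ (suc k) σ = ⇑ (⇑^ k σ)

↑ : Sub
↑ = var ∘ suc

sub : Sub → Fm → Fm
sub σ ⊥' = ⊥'
sub σ (pred p ts) = pred p (map (subT σ) ts)
sub σ (∼ A) = ∼ sub σ A
sub σ (A ∧' B) = sub σ A ∧' sub σ B
sub σ (A ∨' B) = sub σ A ∨' sub σ B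
sub σ (A ⇒ B) = sub σ A ⇒ sub σ B
sub σ (∀' A) = ∀' (sub (⇑ σ) A)
sub σ (∃' A) = ∃' (sub (⇑ σ) A)

infixl 5 _⨾_
_⨾_ : Sub → Sub → Sub
(σ ⨾ τ) i = subT τ (σ i)

subT-⨾ : ∀ σ τ → subT τ ∘ subT σ ≗ subT (σ ⨾ τ)
subT-⨾ σ τ (var i) = refl
subT-⨾ σ τ (con c) = refl

subT-∷ₛ-var-shift : ∀ u x → subT (u ∷ₛ var) (shiftT 0 x) ≡ x
subT-∷ₛ-var-shift u (var i) = refl
subT-∷ₛ-var-shift u (con c) = refl

subT-⇑-shift : ∀ τ x → subT (⇑ τ) (shiftT 0 x) ≡ shiftT 0 (subT τ x)
subT-⇑-shift τ (var i) = refl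
subT-⇑-shift τ (con c) = refl

subT-↑ : subT ↑ ≗ shiftT 0
subT-↑ (var i) = refl
subT-↑ (con c) = refl

subT-cong : ∀ {σ τ} → σ ≗ τ → subT σ ≗ subT τ
subT-cong h (var i) = h i
subT-cong h (con c) = refl

⇑-cong : ∀ {σ τ} → σ ≗ τ → ⇑ σ ≗ ⇑ τ
⇑-cong h zero = refl
⇑-cong h (suc i) = cong (shiftT 0) (h i)

⇑-⨾ : ∀ σ τ → ⇑ σ ⨾ ⇑ τ ≗ ⇑ (σ ⨾ τ)
⇑-⨾ σ τ zero = refl
⇑-⨾ σ τ (suc i) = subT-⇑-shift τ (σ i)

sub-cong : ∀ {σ τ} → σ ≗ τ → sub σ ≗ sub τ
sub-cong h ⊥' = refl
sub-cong h (pred p ts) = cong (pred p) (map-cong (subT-cong h) ts)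
sub-cong h (∼ A) = cong ∼_ (sub-cong h A)
sub-cong h (A ∧' B) = cong₂ _∧'_ (sub-cong h A) (sub-cong h B)
sub-cong h (A ∨' B) = cong₂ _∨'_ (sub-cong h A) (sub-cong h B)
sub-cong h (A ⇒ B) = cong₂ _⇒_ (sub-cong h A) (sub-cong h B)
sub-cong h (∀' A) = cong ∀' (sub-cong (⇑-cong h) A)
sub-cong h (∃' A) = cong ∃' (sub-cong (⇑-cong h) A)

sub-⨾ : ∀ σ τ → sub τ ∘ sub σ ≗ sub (σ ⨾ τ)
sub-⨾ σ τ ⊥' = refl
sub-⨾ σ τ (pred p ts) = cong (pred p) (trans (sym (map-∘ ts)) (map-cong (subT-⨾ σ τ) ts))
sub-⨾ σ τ (∼ A) = cong ∼_ (sub-⨾ σ τ A)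
sub-⨾ σ τ (A ∧' B) = cong₂ _∧'_ (sub-⨾ σ τ A) (sub-⨾ σ τ B)
sub-⨾ σ τ (A ∨' B) = cong₂ _∨'_ (sub-⨾ σ τ A) (sub-⨾ σ τ B)
sub-⨾ σ τ (A ⇒ B) = cong₂ _⇒_ (sub-⨾ σ τ A) (sub-⨾ σ τ B)
sub-⨾ σ τ (∀' A) = cong ∀' (trans (sub-⨾ (⇑ σ) (⇑ τ) A) (sub-cong (⇑-⨾ σ τ) A))
sub-⨾ σ τ (∃' A) = cong ∃' (trans (sub-⨾ (⇑ σ) (⇑ τ) A) (sub-cong (⇑-⨾ σ τ) A))

sub-fuse : ∀ {σ τ υ} → σ ⨾ τ ≗ υ → sub τ ∘ sub σ ≗ sub υ
sub-fuse {σ} {τ} h A = trans (sub-⨾ σ τ A) (sub-cong h A)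

Fixes : ℕ → Sub → Set
Fixes k σ = ∀ {i} → i < k → σ i ≡ var i

⇑-Fixes : ∀ {k σ} → Fixes k σ → Fixes (suc k) (⇑ σ)
⇑-Fixes h {zero} _ = refl
⇑-Fixes h {suc i} (s≤s i<k) = cong (shiftT 0) (h i<k)

subT-id-FreeBelowT : ∀ {k σ} → Fixes k σ → ∀ {u} → FreeBelowT k u → subT σ u ≡ u
subT-id-FreeBelowT h {var i} i<k = h i<k
subT-id-FreeBelowT h {con c} _ = refl

sub-id-FreeBelow : ∀ {k σ} A → Fixes k σ → FreeBelow k A → sub σ A ≡ A
sub-id-FreeBelow ⊥' h _ = refl
sub-id-FreeBelow (pred p ts) h fb = cong (pred p) (map-id-local (All.map (subT-id-FreeBelowT h) fb))
sub-id-FreeBelow (∼ A) h fb = cong ∼_ (sub-id-FreeBelow A h fb)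
sub-id-FreeBelow (A ∧' B) h (fA , fB) = cong₂ _∧'_ (sub-id-FreeBelow A h fA) (sub-id-FreeBelow B h fB)
sub-id-FreeBelow (A ∨' B) h (fA , fB) = cong₂ _∨'_ (sub-id-FreeBelow A h fA) (sub-id-FreeBelow B h fB)
sub-id-FreeBelow (A ⇒ B) h (fA , fB) = cong₂ _⇒_ (sub-id-FreeBelow A h fA) (sub-id-FreeBelow B h fB)
sub-id-FreeBelow (∀' A) h fb = cong ∀' (sub-id-FreeBelow A (⇑-Fixes h) fb)
sub-id-FreeBelow (∃' A) h fb = cong ∃' (sub-id-FreeBelow A (⇑-Fixes h) fb)

shiftT-as-subT : ∀ c → shiftT c ≗ subT (⇑^ c ↑)
shiftT-as-subT c (var i) = shiftVar-as-sub c i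
  where
  shiftVar-as-sub : ∀ c i → var (shiftVar c i) ≡ ⇑^ c ↑ i
  shiftVar-as-sub zero i = refl
  shiftVar-as-sub (suc c) zero = refl
  shiftVar-as-sub (suc c) (suc i) = cong (shiftT 0) (shiftVar-as-sub c i)
shiftT-as-subT c (con k) = refl

substT-as-subT : ∀ k t → substT k t ≗ subT (⇑^ k (t ∷ₛ var))
substT-as-subT k t (var i) = substVar-as-sub k i
  where
  substVar-as-sub : ∀ k i → substVar k t i ≡ ⇑^ k (t ∷ₛ var) i
  substVar-as-sub zero zero = refl
  substVar-as-sub zero (suc i) = refl
  substVar-as-sub (suc k) zero = refl
  substVar-as-sub (suc k) (suc i) = cong (shiftT 0) (substVar-as-sub k i)
substT-as-subT k t (con c) = refl

shiftTs-as-map : ∀ c → shiftTs c ≗ map (shiftT c)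
shiftTs-as-map c [] = refl
shiftTs-as-map c (u ∷ us) = cong (shiftT c u ∷_) (shiftTs-as-map c us)

substTs-as-map : ∀ k t → substTs k t ≗ map (substT k t)
substTs-as-map k t [] = refl
substTs-as-map k t (u ∷ us) = cong (substT k t u ∷_) (substTs-as-map k t us)

shiftF-as-sub : ∀ c → shiftF c ≗ sub (⇑^ c ↑)
shiftF-as-sub c ⊥' = refl
shiftF-as-sub c (pred p ts) =
  cong (pred p) (trans (shiftTs-as-map c ts) (map-cong (shiftT-as-subT c) ts))
shiftF-as-sub c (∼ A) = cong ∼_ (shiftF-as-sub c A)
shiftF-as-sub c (A ∧' B) = cong₂ _∧'_ (shiftF-as-sub c A) (shiftF-as-sub c B)
shiftF-as-sub c (A ∨' B) = cong₂ _∨'_ (shiftF-as-sub c A) (shiftF-as-sub c B)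
shiftF-as-sub c (A ⇒ B) = cong₂ _⇒_ (shiftF-as-sub c A) (shiftF-as-sub c B)
shiftF-as-sub c (∀' A) = cong ∀' (shiftF-as-sub (suc c) A)
shiftF-as-sub c (∃' A) = cong ∃' (shiftF-as-sub (suc c) A)

substF-as-sub : ∀ k t → substF k t ≗ sub (⇑^ k (t ∷ₛ var))
substF-as-sub k t ⊥' = refl
substF-as-sub k t (pred p ts) =
  cong (pred p) (trans (substTs-as-map k t ts) (map-cong (substT-as-subT k t) ts))
substF-as-sub k t (∼ A) = cong ∼_ (substF-as-sub k t A)
substF-as-sub k t (A ∧' B) = cong₂ _∧'_ (substF-as-sub k t A) (substF-as-sub k t B)
substF-as-sub k t (A ∨' B) = cong₂ _∨'_ (substF-as-sub k t A) (substF-as-sub k t B)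
substF-as-sub k t (A ⇒ B) = cong₂ _⇒_ (substF-as-sub k t A) (substF-as-sub k t B)
substF-as-sub k t (∀' A) = cong ∀' (substF-as-sub (suc k) t A)
substF-as-sub k t (∃' A) = cong ∃' (substF-as-sub (suc k) t A)

wk-as-sub : ∀ A → wk A ≡ sub ↑ A
wk-as-sub = shiftF-as-sub 0

[]-as-sub : ∀ A t → A [ t ] ≡ sub (t ∷ₛ var) A
[]-as-sub A t = substF-as-sub 0 t A

sub-[] : ∀ σ A t → sub σ (A [ t ]) ≡ sub (⇑ σ) A [ subT σ t ]
sub-[] σ A t = begin
  sub σ (A [ t ])                        ≡⟨ cong (sub σ) ([]-as-sub A t) ⟩
  sub σ (sub (t ∷ₛ var) A)               ≡⟨ sub-fuse instantiate-then-σ A ⟩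
  sub (subT σ t ∷ₛ σ) A                  ≡⟨ sym (sub-fuse ⇑σ-then-instantiate A) ⟩
  sub (subT σ t ∷ₛ var) (sub (⇑ σ) A)    ≡⟨ sym ([]-as-sub (sub (⇑ σ) A) (subT σ t)) ⟩
  sub (⇑ σ) A [ subT σ t ]               ∎
  where
  open ≡-Reasoning
  instantiate-then-σ : (t ∷ₛ var) ⨾ σ ≗ subT σ t ∷ₛ σ
  instantiate-then-σ zero = refl
  instantiate-then-σ (suc i) = refl
  ⇑σ-then-instantiate : ⇑ σ ⨾ (subT σ t ∷ₛ var) ≗ subT σ t ∷ₛ σ
  ⇑σ-then-instantiate zero = refl
  ⇑σ-then-instantiate (suc i) = subT-∷ₛ-var-shift (subT σ t) (σ i)

sub-wk : ∀ σ B → sub (⇑ σ) (wk B) ≡ wk (sub σ B)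
sub-wk σ B = begin
  sub (⇑ σ) (wk B)       ≡⟨ cong (sub (⇑ σ)) (wk-as-sub B) ⟩
  sub (⇑ σ) (sub ↑ B)    ≡⟨ sub-fuse (λ _ → refl) B ⟩
  sub (shiftT 0 ∘ σ) B   ≡⟨ sym (sub-fuse σ-then-↑ B) ⟩
  sub ↑ (sub σ B)        ≡⟨ sym (wk-as-sub (sub σ B)) ⟩
  wk (sub σ B)           ∎
  where
  open ≡-Reasoning
  σ-then-↑ : σ ⨾ ↑ ≗ shiftT 0 ∘ σ
  σ-then-↑ i = subT-↑ (σ i)

⊢-sub : ∀ {A} → ⊢ A → ∀ σ → ⊢ sub σ A
⊢-sub (ax1 A B) σ = ax1 _ _
⊢-sub (ax2 A B C) σ = ax2 _ _ _
⊢-sub (ax4 A B) σ = ax4 _ _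
⊢-sub (ax5 A B) σ = ax5 _ _
⊢-sub (ax6 A B C) σ = ax6 _ _ _
⊢-sub (ax7 A B) σ = ax7 _ _
⊢-sub (ax8 A B) σ = ax8 _ _
⊢-sub (ax9 A B C) σ = ax9 _ _ _
⊢-sub (ax10 A) σ = ax10 _
⊢-sub (ax11 A t) σ rewrite sub-[] σ A t = ax11 _ _
⊢-sub (ax12 A B) σ rewrite sub-wk σ B = ax12 _ _
⊢-sub (ax13 A B) σ rewrite sub-wk σ B = ax13 _ _
⊢-sub (ax14 A t) σ rewrite sub-[] σ A t = ax14 _ _
⊢-sub (ax15 A) σ = ax15 _
⊢-sub (ax16 A) σ = ax16 _
⊢-sub (ax17 A B) σ = ax17 _ _
⊢-sub (ax18 A B) σ = ax18 _ _
⊢-sub (ax19 A B) σ = ax19 _ _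
⊢-sub (ax20 A) σ = ax20 _
⊢-sub (ax21 A) σ = ax21 _
⊢-sub (i1 A) σ = i1 _
⊢-sub (i2 A) σ = i2 _
⊢-sub (i3 A) σ = i3 _
⊢-sub (mp d e) σ = mp (⊢-sub d σ) (⊢-sub e σ)
⊢-sub (gen d) σ = gen (⊢-sub d (⇑ σ))

⊢-id : ∀ A → ⊢ A ⇒ A
⊢-id A = mp (ax1 A A) (mp (ax1 A (A ⇒ A)) (ax2 A (A ⇒ A) A))

∧-intro : ∀ {A B} → ⊢ A → ⊢ B → ⊢ A ∧' B
∧-intro {A} {B} a b = mp a (mp (mp b (ax1 B A)) (mp (⊢-id A) (ax6 A B A)))

∧-elimˡ : ∀ {A B} → ⊢ A ∧' B → ⊢ A
∧-elimˡ d = mp d (ax4 _ _)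

∧-elimʳ : ∀ {A B} → ⊢ A ∧' B → ⊢ B
∧-elimʳ d = mp d (ax5 _ _)

⇔-elimˡ : ∀ {A B} → ⊢ A ⇔ B → ⊢ A → ⊢ B
⇔-elimˡ d a = mp a (∧-elimˡ d)

⇔-elimʳ : ∀ {A B} → ⊢ A ⇔ B → ⊢ B → ⊢ A
⇔-elimʳ d b = mp b (∧-elimʳ d)

-- Consistency

infixr 4 _⇒ᵇ_
infix 3 _⇔ᵇ_

_⇒ᵇ_ : Bool → Bool → Bool
a ⇒ᵇ b = not a ∨ b

_⇔ᵇ_ : Bool → Bool → Bool
a ⇔ᵇ b = (a ⇒ᵇ b) ∧ (b ⇒ᵇ a)

-- A one-element model in which every predicate is false and ∼ is classical negation.
⟦_⟧ : Fm → Bool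
⟦ ⊥' ⟧ = false
⟦ pred p ts ⟧ = false
⟦ ∼ A ⟧ = not ⟦ A ⟧
⟦ A ∧' B ⟧ = ⟦ A ⟧ ∧ ⟦ B ⟧
⟦ A ∨' B ⟧ = ⟦ A ⟧ ∨ ⟦ B ⟧
⟦ A ⇒ B ⟧ = ⟦ A ⟧ ⇒ᵇ ⟦ B ⟧
⟦ ∀' A ⟧ = ⟦ A ⟧
⟦ ∃' A ⟧ = ⟦ A ⟧

⟦⟧-sub : ∀ σ A → ⟦ sub σ A ⟧ ≡ ⟦ A ⟧
⟦⟧-sub σ ⊥' = refl
⟦⟧-sub σ (pred p ts) = refl
⟦⟧-sub σ (∼ A) = cong not (⟦⟧-sub σ A)
⟦⟧-sub σ (A ∧' B) = cong₂ _∧_ (⟦⟧-sub σ A) (⟦⟧-sub σ B)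
⟦⟧-sub σ (A ∨' B) = cong₂ _∨_ (⟦⟧-sub σ A) (⟦⟧-sub σ B)
⟦⟧-sub σ (A ⇒ B) = cong₂ _⇒ᵇ_ (⟦⟧-sub σ A) (⟦⟧-sub σ B)
⟦⟧-sub σ (∀' A) = ⟦⟧-sub (⇑ σ) A
⟦⟧-sub σ (∃' A) = ⟦⟧-sub (⇑ σ) A

⟦⟧-[] : ∀ A t → ⟦ A [ t ] ⟧ ≡ ⟦ A ⟧
⟦⟧-[] A t = trans (cong ⟦_⟧ ([]-as-sub A t)) (⟦⟧-sub _ A)

⟦⟧-wk : ∀ A → ⟦ wk A ⟧ ≡ ⟦ A ⟧
⟦⟧-wk A = trans (cong ⟦_⟧ (wk-as-sub A)) (⟦⟧-sub ↑ A)

Valid : (Bool → Bool) → Bool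
Valid f = f false ∧ f true

valid : ∀ f → T (Valid f) → ∀ b → T (f b)
valid f v false = proj₁ (to T-∧ v)
valid f v true = proj₂ (to T-∧ v)

tautology₁ : (f : Bool → Bool) → {T (Valid f)} → ∀ a → T (f a)
tautology₁ f {v} = valid f v

tautology₂ : (f : Bool → Bool → Bool) → {T (Valid λ a → Valid (f a))} → ∀ a b → T (f a b)
tautology₂ f {v} a = valid (f a) (tautology₁ (λ a → Valid (f a)) {v} a)

tautology₃ : (f : Bool → Bool → Bool → Bool) → {T (Valid λ a → Valid λ b → Valid (f a b))} →
             ∀ a b c → T (f a b c)
tautology₃ f {v} a b = valid (f a b) (tautology₂ (λ a b → Valid (f a b)) {v} a b)

⇒ᵇ-mp : ∀ {a b} → T a → T (a ⇒ᵇ b) → T b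
⇒ᵇ-mp {true} _ t = t

⊢⇒valid : ∀ {A} → ⊢ A → T ⟦ A ⟧
⊢⇒valid (ax1 A B) = tautology₂ (λ a b → a ⇒ᵇ b ⇒ᵇ a) ⟦ A ⟧ ⟦ B ⟧
⊢⇒valid (ax2 A B C) = tautology₃ (λ a b c → (a ⇒ᵇ b ⇒ᵇ c) ⇒ᵇ (a ⇒ᵇ b) ⇒ᵇ a ⇒ᵇ c) ⟦ A ⟧ ⟦ B ⟧ ⟦ C ⟧
⊢⇒valid (ax4 A B) = tautology₂ (λ a b → a ∧ b ⇒ᵇ a) ⟦ A ⟧ ⟦ B ⟧
⊢⇒valid (ax5 A B) = tautology₂ (λ a b → a ∧ b ⇒ᵇ b) ⟦ A ⟧ ⟦ B ⟧
⊢⇒valid (ax6 A B C) = tautology₃ (λ a b c → (c ⇒ᵇ a) ⇒ᵇ (c ⇒ᵇ b) ⇒ᵇ c ⇒ᵇ a ∧ b) ⟦ A ⟧ ⟦ B ⟧ ⟦ C ⟧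
⊢⇒valid (ax7 A B) = tautology₂ (λ a b → a ⇒ᵇ a ∨ b) ⟦ A ⟧ ⟦ B ⟧
⊢⇒valid (ax8 A B) = tautology₂ (λ a b → b ⇒ᵇ a ∨ b) ⟦ A ⟧ ⟦ B ⟧
⊢⇒valid (ax9 A B C) = tautology₃ (λ a b c → (a ⇒ᵇ c) ⇒ᵇ (b ⇒ᵇ c) ⇒ᵇ a ∨ b ⇒ᵇ c) ⟦ A ⟧ ⟦ B ⟧ ⟦ C ⟧
⊢⇒valid (ax10 A) = tt
⊢⇒valid (ax11 A t) rewrite ⟦⟧-[] A t = tautology₁ (λ a → a ⇒ᵇ a) ⟦ A ⟧
⊢⇒valid (ax12 A B) rewrite ⟦⟧-wk B = tautology₂ (λ a b → (a ⇒ᵇ b) ⇒ᵇ a ⇒ᵇ b) ⟦ A ⟧ ⟦ B ⟧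
⊢⇒valid (ax13 A B) rewrite ⟦⟧-wk B = tautology₂ (λ a b → (b ⇒ᵇ a) ⇒ᵇ b ⇒ᵇ a) ⟦ A ⟧ ⟦ B ⟧
⊢⇒valid (ax14 A t) rewrite ⟦⟧-[] A t = tautology₁ (λ a → a ⇒ᵇ a) ⟦ A ⟧
⊢⇒valid (ax15 A) = tautology₁ (λ a → a ⇒ᵇ not false) ⟦ A ⟧
⊢⇒valid (ax16 A) = tautology₁ (λ a → not (not a) ⇔ᵇ a) ⟦ A ⟧
⊢⇒valid (ax17 A B) = tautology₂ (λ a b → not (a ∧ b) ⇔ᵇ not a ∨ not b) ⟦ A ⟧ ⟦ B ⟧
⊢⇒valid (ax18 A B) = tautology₂ (λ a b → not (a ∨ b) ⇔ᵇ not a ∧ not b) ⟦ A ⟧ ⟦ B ⟧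
⊢⇒valid (ax19 A B) = tautology₂ (λ a b → not (a ⇒ᵇ b) ⇔ᵇ (not a ⇒ᵇ false) ∧ not b) ⟦ A ⟧ ⟦ B ⟧
⊢⇒valid (ax20 A) = tautology₁ (λ a → not a ⇔ᵇ not a) ⟦ A ⟧
⊢⇒valid (ax21 A) = tautology₁ (λ a → not a ⇔ᵇ not a) ⟦ A ⟧
⊢⇒valid (i1 A) = tautology₁ (λ a → ((a ⇒ᵇ false) ⇒ᵇ false) ⇒ᵇ ((a ⇒ᵇ false) ⇒ᵇ false)) ⟦ A ⟧
⊢⇒valid (i2 A) = tautology₁ (λ a → not a ⇒ᵇ a ⇒ᵇ false) ⟦ A ⟧
⊢⇒valid (i3 A) = tautology₁ (λ a → ((a ∨ not a) ⇒ᵇ false) ⇒ᵇ false) ⟦ A ⟧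
⊢⇒valid (mp d e) = ⇒ᵇ-mp (⊢⇒valid d) (⊢⇒valid e)
⊢⇒valid (gen d) = ⊢⇒valid d

consistency : ¬ (⊢ ⊥')
consistency = ⊢⇒valid

-- The slash

Env : Set
Env = ℕ → ℕ

⟪_⟫ : Env → Sub
⟪ ρ ⟫ = con ∘ ρ

ev : Env → Term → ℕ
ev ρ (var i) = ρ i
ev ρ (con c) = c

subT-⟪⟫ : ∀ ρ t → subT ⟪ ρ ⟫ t ≡ con (ev ρ t)
subT-⟪⟫ ρ (var i) = refl
subT-⟪⟫ ρ (con c) = refl

infix 3 _⊩⁺_ _⊩⁻_

-- ρ ⊩⁻ A is the slash of ∼ A; its clauses follow the De Morgan axioms Ax16–Ax21.
mutual
  _⊩⁺_ : Env → Fm → Set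
  ρ ⊩⁺ ⊥' = ⊥
  ρ ⊩⁺ pred p ts = ⊢ sub ⟪ ρ ⟫ (pred p ts)
  ρ ⊩⁺ ∼ A = ρ ⊩⁻ A
  ρ ⊩⁺ A ∧' B = ρ ⊩⁺ A × ρ ⊩⁺ B
  ρ ⊩⁺ A ∨' B = ρ ⊩⁺ A ⊎ ρ ⊩⁺ B
  ρ ⊩⁺ A ⇒ B = ⊢ sub ⟪ ρ ⟫ (A ⇒ B) × (ρ ⊩⁺ A → ρ ⊩⁺ B)
  ρ ⊩⁺ ∀' A = ⊢ sub ⟪ ρ ⟫ (∀' A) × (∀ c → c ∷ₛ ρ ⊩⁺ A)
  ρ ⊩⁺ ∃' A = ∃[ c ] c ∷ₛ ρ ⊩⁺ A

  _⊩⁻_ : Env → Fm → Set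
  ρ ⊩⁻ ⊥' = ⊤
  ρ ⊩⁻ pred p ts = ⊢ sub ⟪ ρ ⟫ (∼ pred p ts)
  ρ ⊩⁻ ∼ A = ρ ⊩⁺ A
  ρ ⊩⁻ A ∧' B = ρ ⊩⁻ A ⊎ ρ ⊩⁻ B
  ρ ⊩⁻ A ∨' B = ρ ⊩⁻ A × ρ ⊩⁻ B
  ρ ⊩⁻ A ⇒ B = (⊢ sub ⟪ ρ ⟫ (¬' (∼ A)) × ¬ (ρ ⊩⁻ A)) × ρ ⊩⁻ B
  ρ ⊩⁻ ∀' A = ∃[ c ] c ∷ₛ ρ ⊩⁻ A
  ρ ⊩⁻ ∃' A = ⊢ sub ⟪ ρ ⟫ (∼ ∃' A) × (∀ c → c ∷ₛ ρ ⊩⁻ A)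

sub-⇑-[] : ∀ ρ c A → sub (⇑ ⟪ ρ ⟫) A [ con c ] ≡ sub ⟪ c ∷ₛ ρ ⟫ A
sub-⇑-[] ρ c A = trans ([]-as-sub (sub (⇑ ⟪ ρ ⟫) A) (con c)) (sub-fuse ⇑ρ-then-c A)
  where
  ⇑ρ-then-c : ⇑ ⟪ ρ ⟫ ⨾ (con c ∷ₛ var) ≗ ⟪ c ∷ₛ ρ ⟫
  ⇑ρ-then-c zero = refl
  ⇑ρ-then-c (suc i) = refl

∃-intro : ∀ ρ c A → ⊢ sub ⟪ c ∷ₛ ρ ⟫ A → ⊢ sub ⟪ ρ ⟫ (∃' A)
∃-intro ρ c A d = mp (subst ⊢_ (sym (sub-⇑-[] ρ c A)) d) (ax11 _ (con c))

mutual
  ⊩⁺⇒⊢ : ∀ {ρ} A → ρ ⊩⁺ A → ⊢ sub ⟪ ρ ⟫ A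
  ⊩⁺⇒⊢ (pred p ts) d = d
  ⊩⁺⇒⊢ (∼ A) s = ⊩⁻⇒⊢ A s
  ⊩⁺⇒⊢ (A ∧' B) (a , b) = ∧-intro (⊩⁺⇒⊢ A a) (⊩⁺⇒⊢ B b)
  ⊩⁺⇒⊢ (A ∨' B) (inj₁ a) = mp (⊩⁺⇒⊢ A a) (ax7 _ _)
  ⊩⁺⇒⊢ (A ∨' B) (inj₂ b) = mp (⊩⁺⇒⊢ B b) (ax8 _ _)
  ⊩⁺⇒⊢ (A ⇒ B) (d , _) = d
  ⊩⁺⇒⊢ (∀' A) (d , _) = d
  ⊩⁺⇒⊢ {ρ} (∃' A) (c , a) = ∃-intro ρ c A (⊩⁺⇒⊢ A a)

  ⊩⁻⇒⊢ : ∀ {ρ} A → ρ ⊩⁻ A → ⊢ sub ⟪ ρ ⟫ (∼ A)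
  ⊩⁻⇒⊢ ⊥' _ = mp (⊢-id (⊥' ⇒ ⊥')) (ax15 _)
  ⊩⁻⇒⊢ (pred p ts) d = d
  ⊩⁻⇒⊢ (∼ A) a = ⇔-elimʳ (ax16 _) (⊩⁺⇒⊢ A a)
  ⊩⁻⇒⊢ (A ∧' B) (inj₁ a) = ⇔-elimʳ (ax17 _ _) (mp (⊩⁻⇒⊢ A a) (ax7 _ _))
  ⊩⁻⇒⊢ (A ∧' B) (inj₂ b) = ⇔-elimʳ (ax17 _ _) (mp (⊩⁻⇒⊢ B b) (ax8 _ _))
  ⊩⁻⇒⊢ (A ∨' B) (a , b) = ⇔-elimʳ (ax18 _ _) (∧-intro (⊩⁻⇒⊢ A a) (⊩⁻⇒⊢ B b))
  ⊩⁻⇒⊢ (A ⇒ B) ((d , _) , b) = ⇔-elimʳ (ax19 _ _) (∧-intro d (⊩⁻⇒⊢ B b))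
  ⊩⁻⇒⊢ {ρ} (∀' A) (c , a) = ⇔-elimʳ (ax20 _) (∃-intro ρ c (∼ A) (⊩⁻⇒⊢ A a))
  ⊩⁻⇒⊢ (∃' A) (d , _) = d

∀-⇔ : {P Q : ℕ → Set} → (∀ c → P c ⟺ Q c) → (∀ c → P c) ⟺ (∀ c → Q c)
∀-⇔ h = mk⇔ (λ p c → to (h c) (p c)) (λ q c → from (h c) (q c))

∃-⇔ : {P Q : ℕ → Set} → (∀ c → P c ⟺ Q c) → (∃[ c ] P c) ⟺ (∃[ c ] Q c)
∃-⇔ h = mk⇔ (λ (c , p) → c , to (h c) p) (λ (c , q) → c , from (h c) q)

subT-⟪∷ₛ⟫-shift : ∀ c ρ x → subT ⟪ c ∷ₛ ρ ⟫ (shiftT 0 x) ≡ subT ⟪ ρ ⟫ x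
subT-⟪∷ₛ⟫-shift c ρ (var i) = refl
subT-⟪∷ₛ⟫-shift c ρ (con d) = refl

⇑-⨾-⟪⟫ : ∀ {σ ρ ρ'} c → σ ⨾ ⟪ ρ ⟫ ≗ ⟪ ρ' ⟫ → ⇑ σ ⨾ ⟪ c ∷ₛ ρ ⟫ ≗ ⟪ c ∷ₛ ρ' ⟫
⇑-⨾-⟪⟫ c h zero = refl
⇑-⨾-⟪⟫ {σ} {ρ} c h (suc i) = trans (subT-⟪∷ₛ⟫-shift c ρ (σ i)) (h i)

⊢-sub-⟪⟫ : ∀ {σ ρ ρ'} → σ ⨾ ⟪ ρ ⟫ ≗ ⟪ ρ' ⟫ → ∀ A → (⊢ sub ⟪ ρ ⟫ (sub σ A)) ⟺ (⊢ sub ⟪ ρ' ⟫ A)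
⊢-sub-⟪⟫ h A = mk⇔ (subst ⊢_ (sub-fuse h A)) (subst ⊢_ (sym (sub-fuse h A)))

mutual
  ⊩⁺-sub : ∀ {σ ρ ρ'} → σ ⨾ ⟪ ρ ⟫ ≗ ⟪ ρ' ⟫ → ∀ A → (ρ ⊩⁺ sub σ A) ⟺ (ρ' ⊩⁺ A)
  ⊩⁺-sub h ⊥' = ⇔-id _
  ⊩⁺-sub h (pred p ts) = ⊢-sub-⟪⟫ h (pred p ts)
  ⊩⁺-sub h (∼ A) = ⊩⁻-sub h A
  ⊩⁺-sub h (A ∧' B) = ⊩⁺-sub h A ×-⇔ ⊩⁺-sub h B
  ⊩⁺-sub h (A ∨' B) = ⊩⁺-sub h A ⊎-⇔ ⊩⁺-sub h B
  ⊩⁺-sub h (A ⇒ B) = ⊢-sub-⟪⟫ h (A ⇒ B) ×-⇔ →-cong-⇔ (⊩⁺-sub h A) (⊩⁺-sub h B)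
  ⊩⁺-sub h (∀' A) = ⊢-sub-⟪⟫ h (∀' A) ×-⇔ ∀-⇔ λ c → ⊩⁺-sub (⇑-⨾-⟪⟫ c h) A
  ⊩⁺-sub h (∃' A) = ∃-⇔ λ c → ⊩⁺-sub (⇑-⨾-⟪⟫ c h) A

  ⊩⁻-sub : ∀ {σ ρ ρ'} → σ ⨾ ⟪ ρ ⟫ ≗ ⟪ ρ' ⟫ → ∀ A → (ρ ⊩⁻ sub σ A) ⟺ (ρ' ⊩⁻ A)
  ⊩⁻-sub h ⊥' = ⇔-id _
  ⊩⁻-sub h (pred p ts) = ⊢-sub-⟪⟫ h (∼ pred p ts)
  ⊩⁻-sub h (∼ A) = ⊩⁺-sub h A
  ⊩⁻-sub h (A ∧' B) = ⊩⁻-sub h A ⊎-⇔ ⊩⁻-sub h B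
  ⊩⁻-sub h (A ∨' B) = ⊩⁻-sub h A ×-⇔ ⊩⁻-sub h B
  ⊩⁻-sub h (A ⇒ B) =
    (⊢-sub-⟪⟫ h (¬' (∼ A)) ×-⇔ →-cong-⇔ (⊩⁻-sub h A) (⇔-id ⊥)) ×-⇔ ⊩⁻-sub h B
  ⊩⁻-sub h (∀' A) = ∃-⇔ λ c → ⊩⁻-sub (⇑-⨾-⟪⟫ c h) A
  ⊩⁻-sub h (∃' A) = ⊢-sub-⟪⟫ h (∼ ∃' A) ×-⇔ ∀-⇔ λ c → ⊩⁻-sub (⇑-⨾-⟪⟫ c h) A

⊩⁺-[] : ∀ ρ A t → (ρ ⊩⁺ A [ t ]) ⟺ (ev ρ t ∷ₛ ρ ⊩⁺ A)
⊩⁺-[] ρ A t = subst (λ X → (ρ ⊩⁺ X) ⟺ (ev ρ t ∷ₛ ρ ⊩⁺ A)) (sym ([]-as-sub A t)) (⊩⁺-sub t-then-ρ A)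
  where
  t-then-ρ : (t ∷ₛ var) ⨾ ⟪ ρ ⟫ ≗ ⟪ ev ρ t ∷ₛ ρ ⟫
  t-then-ρ zero = subT-⟪⟫ ρ t
  t-then-ρ (suc i) = refl

⊩⁺-wk : ∀ ρ c B → (c ∷ₛ ρ ⊩⁺ wk B) ⟺ (ρ ⊩⁺ B)
⊩⁺-wk ρ c B = subst (λ X → (c ∷ₛ ρ ⊩⁺ X) ⟺ (ρ ⊩⁺ B)) (sym (wk-as-sub B)) (⊩⁺-sub (λ _ → refl) B)

⊩⇒-intro : ∀ {ρ A B} → ⊢ sub ⟪ ρ ⟫ (A ⇒ B) → (ρ ⊩⁺ A → ⊢ sub ⟪ ρ ⟫ B → ρ ⊩⁺ B) → ρ ⊩⁺ A ⇒ B
⊩⇒-intro {A = A} d f = d , λ a → f a (mp (⊩⁺⇒⊢ A a) d)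

⊩⇔-intro : ∀ {ρ A B} → ⊢ sub ⟪ ρ ⟫ (A ⇔ B) → (ρ ⊩⁺ A → ρ ⊩⁺ B) → (ρ ⊩⁺ B → ρ ⊩⁺ A) →
           ρ ⊩⁺ A ⇔ B
⊩⇔-intro d f g = (∧-elimˡ d , f) , (∧-elimʳ d , g)

⊢⇒⊩ : ∀ {A} → ⊢ A → ∀ ρ → ρ ⊩⁺ A
⊢⇒⊩ ax@(ax1 A B) ρ = ⊩⇒-intro (⊢-sub ax ⟪ ρ ⟫) λ a d → ⊩⇒-intro d λ _ _ → a
⊢⇒⊩ ax@(ax2 A B C) ρ = ⊩⇒-intro (⊢-sub ax ⟪ ρ ⟫) λ f d₁ → ⊩⇒-intro d₁ λ g d₂ → ⊩⇒-intro d₂ λ a _ →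
  proj₂ (proj₂ f a) (proj₂ g a)
⊢⇒⊩ ax@(ax4 A B) ρ = ⊢-sub ax ⟪ ρ ⟫ , proj₁
⊢⇒⊩ ax@(ax5 A B) ρ = ⊢-sub ax ⟪ ρ ⟫ , proj₂
⊢⇒⊩ ax@(ax6 A B C) ρ = ⊩⇒-intro (⊢-sub ax ⟪ ρ ⟫) λ f d₁ → ⊩⇒-intro d₁ λ g d₂ → ⊩⇒-intro d₂ λ c _ →
  proj₂ f c , proj₂ g c
⊢⇒⊩ ax@(ax7 A B) ρ = ⊢-sub ax ⟪ ρ ⟫ , inj₁
⊢⇒⊩ ax@(ax8 A B) ρ = ⊢-sub ax ⟪ ρ ⟫ , inj₂
⊢⇒⊩ ax@(ax9 A B C) ρ = ⊩⇒-intro (⊢-sub ax ⟪ ρ ⟫) λ f d₁ → ⊩⇒-intro d₁ λ g d₂ → ⊩⇒-intro d₂ λ where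
  (inj₁ a) _ → proj₂ f a
  (inj₂ b) _ → proj₂ g b
⊢⇒⊩ ax@(ax10 A) ρ = ⊢-sub ax ⟪ ρ ⟫ , λ ()
⊢⇒⊩ ax@(ax11 A t) ρ = ⊢-sub ax ⟪ ρ ⟫ , λ a → ev ρ t , to (⊩⁺-[] ρ A t) a
⊢⇒⊩ ax@(ax12 A B) ρ = ⊩⇒-intro (⊢-sub ax ⟪ ρ ⟫) λ f d → ⊩⇒-intro d λ (c , a) _ →
  to (⊩⁺-wk ρ c B) (proj₂ (proj₂ f c) a)
⊢⇒⊩ ax@(ax13 A B) ρ = ⊩⇒-intro (⊢-sub ax ⟪ ρ ⟫) λ f d₁ → ⊩⇒-intro d₁ λ b d₂ → d₂ , λ c →
  proj₂ (proj₂ f c) (from (⊩⁺-wk ρ c B) b)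
⊢⇒⊩ ax@(ax14 A t) ρ = ⊢-sub ax ⟪ ρ ⟫ , λ f → from (⊩⁺-[] ρ A t) (proj₂ f (ev ρ t))
⊢⇒⊩ ax@(ax15 A) ρ = ⊢-sub ax ⟪ ρ ⟫ , λ _ → tt
⊢⇒⊩ ax@(ax16 A) ρ = ⊩⇔-intro (⊢-sub ax ⟪ ρ ⟫) id id
⊢⇒⊩ ax@(ax17 A B) ρ = ⊩⇔-intro (⊢-sub ax ⟪ ρ ⟫) id id
⊢⇒⊩ ax@(ax18 A B) ρ = ⊩⇔-intro (⊢-sub ax ⟪ ρ ⟫) id id
⊢⇒⊩ ax@(ax19 A B) ρ = ⊩⇔-intro (⊢-sub ax ⟪ ρ ⟫) id id
⊢⇒⊩ ax@(ax20 A) ρ = ⊩⇔-intro (⊢-sub ax ⟪ ρ ⟫) id id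
⊢⇒⊩ ax@(ax21 A) ρ = ⊩⇔-intro d (λ (n , f) → ⇔-elimˡ d n , f) (λ (n , f) → ⇔-elimʳ d n , f)
  where d = ⊢-sub ax ⟪ ρ ⟫
⊢⇒⊩ ax@(i1 A) ρ = ⊩⇒-intro (⊢-sub ax ⟪ ρ ⟫) λ _ d → d , λ (d' , _) → consistency (mp d' d)
⊢⇒⊩ ax@(i2 A) ρ = ⊩⇒-intro (⊢-sub ax ⟪ ρ ⟫) λ _ d → d , λ a → consistency (mp (⊩⁺⇒⊢ A a) d)
⊢⇒⊩ ax@(i3 A) ρ = d , λ (d' , _) → consistency (mp d' d)
  where d = ⊢-sub ax ⟪ ρ ⟫
⊢⇒⊩ (mp a f) ρ = proj₂ (⊢⇒⊩ f ρ) (⊢⇒⊩ a ρ)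
⊢⇒⊩ g@(gen d) ρ = ⊢-sub g ⟪ ρ ⟫ , λ c → ⊢⇒⊩ d (c ∷ₛ ρ)

Sentence-⊩⁺⇒⊢ : ∀ {ρ} A → Sentence A → ρ ⊩⁺ A → ⊢ A
Sentence-⊩⁺⇒⊢ A sA a = subst ⊢_ (sub-id-FreeBelow A (λ ()) sA) (⊩⁺⇒⊢ A a)

instance-⊩⁺⇒⊢ : ∀ {ρ c} A → FreeBelow 1 A → c ∷ₛ ρ ⊩⁺ A → ⊢ A [ con c ]
instance-⊩⁺⇒⊢ {ρ} {c} A fA a = subst ⊢_ instance-closes (⊩⁺⇒⊢ A a)
  where
  instance-closes : sub ⟪ c ∷ₛ ρ ⟫ A ≡ A [ con c ]
  instance-closes = trans (sym (sub-⇑-[] ρ c A))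
                          (cong (_[ con c ]) (sub-id-FreeBelow A (⇑-Fixes (λ ())) fA))

theorem3p11 : (∀ A B → Sentence A → Sentence B → ⊢ A ∨' B → (⊢ A) ⊎ (⊢ B))
    × (∀ A → Sentence (∃' A) → ⊢ ∃' A → ∃[ c ] (⊢ A [ con c ]))
    × (∀ A B → Sentence A → Sentence B → ⊢ ∼ (A ∧' B) → (⊢ ∼ A) ⊎ (⊢ ∼ B))
    × (∀ A → Sentence (∀' A) → ⊢ ∼ ∀' A → ∃[ c ] (⊢ ∼ (A [ con c ])))
theorem3p11 =
    (λ A B sA sB d → Sum.map (Sentence-⊩⁺⇒⊢ A sA) (Sentence-⊩⁺⇒⊢ B sB) (⊢⇒⊩ d ρ₀))
  , (λ A sA d → let (c , a) = ⊢⇒⊩ d ρ₀ in c , instance-⊩⁺⇒⊢ A sA a)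
  , (λ A B sA sB d → Sum.map (Sentence-⊩⁺⇒⊢ (∼ A) sA) (Sentence-⊩⁺⇒⊢ (∼ B) sB) (⊢⇒⊩ d ρ₀))
  , (λ A sA d → let (c , a) = ⊢⇒⊩ d ρ₀ in c , instance-⊩⁺⇒⊢ (∼ A) sA a)
  where
  ρ₀ : Env
  ρ₀ _ = 0
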